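{- For every $n\ge 3$, every optimal matching preclusion set of the $n$-dimensional bubble-sort star graph $BS_n$ is trivial.
   Context: For a permutation $v=v_1v_2\cdots v_n$ of $[1,n]$ and distinct $i,j$, $v\circ\langle i,j\rangle$ denotes the permutation obtained from $v$ by exchanging the entries in positions $i$ and $j$. The bubble-sort star graph $BS_n$ has as vertex set all permutations of $[1,n]$, and distinct $u,v$ are adjacent iff $u=v\circ\langle 1,i\rangle$ for some $i\in[2,n]$ or $u=v\circ\langle i-1,i\rangle$ for some $i\in[3,n]$. A perfect matching covers every vertex; an almost-perfect matching covers all vertices but one. The matching preclusion number $\mathrm{mp}(G)$ is the minimum size of an edge set $F\subseteq E(G)$ such that $G-F$ has neither a perfect matching nor an almost-perfect matching; such an $F$ of size $\mathrm{mp}(G)$ is an optimal matching preclusion set. An optimal matching preclusion set is trivial if all its edges are incident with one common vertex. -}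

module Defs where

open import Data.Nat using (ℕ; suc; _≤_)
open import Data.Fin using (Fin; toℕ; zero; suc; inject₁)
open import Data.Fin.Permutation.Components using (transpose)
open import Data.Vec using (Vec; lookup; tabulate)
open import Data.List using (List; length)
import Data.List as L
open import Data.List.Relation.Unary.All using (All)
open import Data.List.Relation.Unary.Any using (Any)
open import Data.Product using (Σ; ∃; ∃-syntax; _×_; _,_; proj₁; proj₂)
open import Data.Sum using (_⊎_)
open import Relation.Nullary using (¬_)
open import Relation.Binary.PropositionalEquality using (_≡_; _≢_)

-- A word v₁…vₙ over [1,n], with entries encoded as Fin n (value k+1 ↦ k)
-- and positions 1..n encoded as Fin n indices 0..n-1.
Word : ℕ → Set
Word n = Vec (Fin n) n

IsPerm : ∀ {n} → Word n → Set
IsPerm {n} v = ∀ (i j : Fin n) → lookup v i ≡ lookup v j → i ≡ j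

swapPos : ∀ {n} → Word n → Fin n → Fin n → Word n
swapPos v i j = tabulate (λ k → lookup v (transpose i j k))

-- Adjacency in BS_n (0-indexed positions):
--  * u = v ∘ ⟨1,i⟩, i ∈ [2,n]  ↔  swap index 0 with index i' ≠ 0;
--  * u = v ∘ ⟨i-1,i⟩, i ∈ [3,n]  ↔  swap indices k and k+1 with k ≥ 1.
Adj : ∀ {n} → Word (suc n) → Word (suc n) → Set
Adj {n} u v =
  (∃[ i ] (i ≢ zero × u ≡ swapPos v zero i))
  ⊎ (∃[ k ] (1 ≤ toℕ k × u ≡ swapPos v (inject₁ k) (suc k)))

-- (Ordered representations of) edges of BS_n.
Pair : ℕ → Set
Pair n = Word n × Word n

IsEdge : ∀ {n} → Pair (suc n) → Set
IsEdge (u , v) = IsPerm u × IsPerm v × Adj u v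

SameEdge : ∀ {n} → Pair n → Pair n → Set
SameEdge (u , v) (u' , v') = (u ≡ u' × v ≡ v') ⊎ (u ≡ v' × v ≡ u')

-- An edge set F ⊆ E(BS_n), given as a duplicate-free list of edges
-- (no unordered edge listed twice), so |F| = length F.
IsEdgeSet : ∀ {n} → List (Pair (suc n)) → Set
IsEdgeSet F =
  All IsEdge F ×
  (∀ (i j : Fin (length F)) → i ≢ j → ¬ SameEdge (L.lookup F i) (L.lookup F j))

_∈E_ : ∀ {n} → Pair n → List (Pair n) → Set
e ∈E F = Any (SameEdge e) F

Incident : ∀ {n} → Word n → Pair n → Set
Incident w (u , v) = w ≡ u ⊎ w ≡ v

IsMatchingIn : ∀ {n} → List (Pair (suc n)) → List (Pair (suc n)) → Set
IsMatchingIn {n} F M =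
  All (λ e → IsEdge e × ¬ (e ∈E F)) M ×
  (∀ (i j : Fin (length M)) → i ≢ j →
     ∀ (w : Word (suc n)) → Incident w (L.lookup M i) → ¬ Incident w (L.lookup M j))

Covers : ∀ {n} → List (Pair n) → Word n → Set
Covers M w = Any (Incident w) M

IsPerfectMatchingIn : ∀ {n} → List (Pair (suc n)) → List (Pair (suc n)) → Set
IsPerfectMatchingIn {n} F M =
  IsMatchingIn F M × (∀ (w : Word (suc n)) → IsPerm w → Covers M w)

IsAlmostPerfectMatchingIn : ∀ {n} → List (Pair (suc n)) → List (Pair (suc n)) → Set
IsAlmostPerfectMatchingIn {n} F M =
  IsMatchingIn F M ×
  Σ (Word (suc n)) (λ x → IsPerm x × ¬ Covers M x ×
     (∀ (w : Word (suc n)) → IsPerm w → w ≢ x → Covers M w))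

IsMatchingPreclusionSet : ∀ {n} → List (Pair (suc n)) → Set
IsMatchingPreclusionSet F =
  IsEdgeSet F ×
  ¬ (∃ λ M → IsPerfectMatchingIn F M) ×
  ¬ (∃ λ M → IsAlmostPerfectMatchingIn F M)

IsOptimalMPS : ∀ {n} → List (Pair (suc n)) → Set
IsOptimalMPS {n} F =
  IsMatchingPreclusionSet F ×
  (∀ (F' : List (Pair (suc n))) → IsMatchingPreclusionSet F' → length F ≤ length F')

IsTrivial : ∀ {n} → List (Pair (suc n)) → Set
IsTrivial {n} F = Σ (Word (suc n)) (λ w → IsPerm w × All (Incident w) F)

-- Write BS_n as a Cayley graph: u ~ v iff u = v·g for one of the 2n−3 generating transpositions g,
-- and call {v, v·g} a g-edge.  The star of a vertex is a matching preclusion set of size 2n−3: it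
-- isolates the vertex, and no almost perfect matching exists at all because n! is even.  Conversely,
-- the g-edges form a perfect matching, so a preclusion set F with |F| ≤ 2n−3 contains exactly one
-- g-edge for every g.  If s, t, u satisfy y·u·s = y·s·t, then switching the s-matching along the
-- 4-cycle x, x·s, x·s·t, x·u shows that F's s-edge {x, x·s} is accompanied by F's t-edge at x·s or
-- F's u-edge at x.  For the triangle ⟨1,k+2⟩, ⟨1,k+3⟩, ⟨k+2,k+3⟩ this puts the three edges of F at a
-- common corner; consecutive triangles share a generator, and a switch with the commuting pair
-- ⟨1,k+2⟩, ⟨k+3,k+4⟩ shows that they share the corner, which is thus incident with all of F.

module Submission where

open import Data.Empty using (⊥; ⊥-elim)
open import Data.Fin as Fin using (Fin; zero; suc; inject₁; splitAt; join)
open import Data.Fin.Induction using (<-weakInduction)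
open import Data.Fin.Permutation.Components using (transpose)
import Data.Fin.Properties as Finₚ
open import Data.List as List using (List; []; _∷_; length; map; filter; allFin; cartesianProductWith)
import Data.List.Properties as Listₚ
open import Data.List.Membership.Propositional using (_∈_)
open import Data.List.Membership.Propositional.Properties
  using (∈-allFin; ∈-cartesianProductWith⁺; ∈-filter⁺; ∈-filter⁻; ∈-lookup; ∈-map⁺)
open import Data.List.Relation.Unary.All as All using (All)
import Data.List.Relation.Unary.All.Properties as Allₚ
open import Data.List.Relation.Unary.AllPairs as AllPairs using (AllPairs; _∷_)
import Data.List.Relation.Unary.AllPairs.Properties as AllPairsₚ
open import Data.List.Relation.Unary.Any as Any using (Any; here; there)
import Data.List.Relation.Unary.Any.Properties as Anyₚ
open import Data.List.Relation.Unary.Unique.Propositional using (Unique)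
open import Data.List.Relation.Unary.Unique.Propositional.Properties
  using (allFin⁺; cartesianProductWith⁺; filter⁺; map⁺)
open import Data.Nat using (ℕ; zero; suc; _+_; _*_; _≤_; z≤n; s≤s)
import Data.Nat.Properties as ℕₚ
open import Data.Product using (Σ; ∃; ∃-syntax; _×_; _,_; proj₁; proj₂)
open import Data.Sum using (_⊎_; inj₁; inj₂)
open import Data.Vec using (Vec; []; _∷_; lookup; tabulate)
open import Data.Vec.Properties using (lookup∘tabulate; tabulate∘lookup; tabulate-cong; ≡-dec; ∷-injective)
import Data.Vec.Relation.Binary.Lex.Strict as Lex
open import Data.Vec.Relation.Binary.Pointwise.Inductive using (Pointwise-≡⇒≡)
open import Function using (_∘_)
open import Function.Definitions using (Injective)
open import Relation.Binary.Bundles using (StrictTotalOrder)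
open import Relation.Binary.Definitions using (DecidableEquality; tri<; tri≈; tri>)
open import Relation.Binary.PropositionalEquality
open import Relation.Nullary using (¬_; Dec; yes; no)
open import Relation.Nullary.Decidable using (dec-true; dec-false; ¬?; _×-dec_; _⊎-dec_; _→-dec_)

open import Defs

transpose-matchˡ : ∀ {n} (i j : Fin n) → transpose i j i ≡ j
transpose-matchˡ i j rewrite dec-true (i Finₚ.≟ i) refl = refl

transpose-matchʳ : ∀ {n} (i j : Fin n) → transpose i j j ≡ i
transpose-matchʳ i j with j Finₚ.≟ i
... | yes j≡i = j≡i
... | no  _   rewrite dec-true (j Finₚ.≟ j) refl = refl

transpose-mismatch : ∀ {n} {i j k : Fin n} → k ≢ i → k ≢ j → transpose i j k ≡ k
transpose-mismatch {i = i} {j} {k} k≢i k≢j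
  rewrite dec-false (k Finₚ.≟ i) k≢i | dec-false (k Finₚ.≟ j) k≢j = refl

transpose-involutive : ∀ {n} (i j k : Fin n) → transpose i j (transpose i j k) ≡ k
transpose-involutive i j k = by-cases (k Finₚ.≟ i) (k Finₚ.≟ j)
  where
  by-cases : Dec (k ≡ i) → Dec (k ≡ j) → transpose i j (transpose i j k) ≡ k
  by-cases (yes refl) _ = trans (cong (transpose k j) (transpose-matchˡ k j)) (transpose-matchʳ k j)
  by-cases (no _) (yes refl) = trans (cong (transpose i k) (transpose-matchʳ i k)) (transpose-matchˡ i k)
  by-cases (no k≢i) (no k≢j) =
    trans (cong (transpose i j) (transpose-mismatch k≢i k≢j)) (transpose-mismatch k≢i k≢j)

transpose-support : ∀ {n} {i j k l : Fin n} → i ≢ j → (∀ p → transpose i j p ≡ transpose k l p) →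
  (i ≡ k × j ≡ l) ⊎ (i ≡ l × j ≡ k)
transpose-support {i = i} {j} {k} {l} i≢j same = by-cases (i Finₚ.≟ k) (i Finₚ.≟ l)
  where
  j≡ : transpose k l i ≡ j
  j≡ = trans (sym (same i)) (transpose-matchˡ i j)
  by-cases : Dec (i ≡ k) → Dec (i ≡ l) → (i ≡ k × j ≡ l) ⊎ (i ≡ l × j ≡ k)
  by-cases (yes refl) _ = inj₁ (refl , trans (sym j≡) (transpose-matchˡ i l))
  by-cases (no _) (yes refl) = inj₂ (refl , trans (sym j≡) (transpose-matchʳ k i))
  by-cases (no i≢k) (no i≢l) = ⊥-elim (i≢j (trans (sym (transpose-mismatch i≢k i≢l)) j≡))

transpose-conjugate : ∀ {n n′} (f : Fin n → Fin n′) → Injective _≡_ _≡_ f → ∀ c d p →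
  f (transpose c d p) ≡ transpose (f c) (f d) (f p)
transpose-conjugate f f-inj c d p = by-cases (p Finₚ.≟ c) (p Finₚ.≟ d)
  where
  by-cases : Dec (p ≡ c) → Dec (p ≡ d) → f (transpose c d p) ≡ transpose (f c) (f d) (f p)
  by-cases (yes refl) _ = trans (cong f (transpose-matchˡ p d)) (sym (transpose-matchˡ (f p) (f d)))
  by-cases (no _) (yes refl) = trans (cong f (transpose-matchʳ c p)) (sym (transpose-matchʳ (f c) (f p)))
  by-cases (no p≢c) (no p≢d) = trans (cong f (transpose-mismatch p≢c p≢d))
    (sym (transpose-mismatch (p≢c ∘ f-inj) (p≢d ∘ f-inj)))

inject₁<suc : ∀ {n} (i : Fin n) → inject₁ i Fin.< suc i
inject₁<suc i = Finₚ.≤̄⇒inject₁< ℕₚ.≤-refl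

-- Pigeonhole and parity

retraction⇒injective : ∀ {a b} (f : Fin a → Fin b) (g : Fin b → Fin a) → (∀ y → f (g y) ≡ y) →
  a ≤ b → Injective _≡_ _≡_ f
retraction⇒injective {a} {b} f g f∘g≗id a≤b {i} {j} fi≡fj with i Finₚ.≟ j
... | yes i≡j = i≡j
... | no  i≢j = ⊥-elim (no-collision (Finₚ.pigeonhole (s≤s a≤b) extend))
  where
  -- One of i, j lies outside the image of g; adding it to g would inject Fin (1 + b) into Fin a.
  outside : ∃[ i₀ ] i₀ ≢ g (f i) × f i₀ ≡ f i
  outside with i Finₚ.≟ g (f i)
  ... | yes i≡gfi = j , (λ j≡gfi → i≢j (trans i≡gfi (sym j≡gfi))) , sym fi≡fj
  ... | no  i≢gfi = i , i≢gfi , refl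
  i₀ = proj₁ outside
  extend : Fin (suc b) → Fin a
  extend zero    = i₀
  extend (suc y) = g y
  no-collision : ¬ (∃[ x ] ∃[ y ] x Fin.< y × extend x ≡ extend y)
  no-collision (zero  , suc y , _   , i₀≡gy) = proj₁ (proj₂ outside)
    (trans i₀≡gy (cong g (trans (sym (f∘g≗id y)) (trans (cong f (sym i₀≡gy)) (proj₂ (proj₂ outside))))))
  no-collision (suc x , suc y , x<y , gx≡gy) =
    Finₚ.<-irrefl (cong suc (trans (sym (f∘g≗id x)) (trans (cong f gx≡gy) (f∘g≗id y)))) x<y

module _ {A : Set} (_≟_ : DecidableEquality A) where

  remove : A → List A → List A
  remove x = filter (λ y → ¬? (y ≟ x))

  ∈-remove⁻ : ∀ {x y xs} → y ∈ remove x xs → y ∈ xs × y ≢ x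
  ∈-remove⁻ {x} {xs = xs} = ∈-filter⁻ (λ y → ¬? (y ≟ x)) {xs = xs}

  ∈-remove⁺ : ∀ {x y xs} → y ∈ xs → y ≢ x → y ∈ remove x xs
  ∈-remove⁺ {x} = ∈-filter⁺ (λ y → ¬? (y ≟ x))

  remove-unique : ∀ x {xs} → Unique xs → Unique (remove x xs)
  remove-unique x = filter⁺ (λ y → ¬? (y ≟ x))

  length-remove : ∀ {x xs} → Unique xs → x ∈ xs → length xs ≡ suc (length (remove x xs))
  length-remove {x} {x ∷ xs} (x∉xs ∷ _) (here refl)
    rewrite Listₚ.filter-reject (λ y → ¬? (y ≟ x)) {x = x} {xs = xs} (λ x≢x → x≢x refl)
          | Listₚ.filter-all (λ y → ¬? (y ≟ x)) (All.map (λ x≢y y≡x → x≢y (sym y≡x)) x∉xs) = refl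
  length-remove {x} {y ∷ xs} (y∉xs ∷ xs-unique) (there x∈xs) with y ≟ x
  ... | yes refl = ⊥-elim (All.lookup y∉xs x∈xs refl)
  ... | no _     = cong suc (length-remove xs-unique x∈xs)

  record IsPairingOn (q : A → A) (xs : List A) : Set where
    field
      closed         : ∀ {a} → a ∈ xs → q a ∈ xs
      involutive     : ∀ {a} → a ∈ xs → q (q a) ≡ a
      no-fixed-point : ∀ {a} → a ∈ xs → q a ≢ a

  pairing⇒even : ∀ {q xs} → Unique xs → IsPairingOn q xs → ∃[ k ] length xs ≡ 2 * k
  pairing⇒even {q} {xs} = bounded (length xs) ℕₚ.≤-refl
    where
    bounded : ∀ s {xs} → length xs ≤ s → Unique xs → IsPairingOn q xs → ∃[ k ] length xs ≡ 2 * k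
    bounded _       {[]}     _         _                  _       = 0 , refl
    bounded (suc s) {a ∷ xs} (s≤s len) (a∉xs ∷ xs-unique) pairing with IsPairingOn.closed pairing (here refl)
    ... | here qa≡a   = ⊥-elim (IsPairingOn.no-fixed-point pairing (here refl) qa≡a)
    ... | there qa∈xs = suc k , (begin
      suc (length xs)                      ≡⟨ cong suc (length-remove xs-unique qa∈xs) ⟩
      suc (suc (length (remove (q a) xs))) ≡⟨ cong (λ l → suc (suc l)) k-even ⟩
      suc (suc (2 * k))                    ≡⟨ ℕₚ.*-suc 2 k ⟨
      2 * suc k                            ∎)
      where
      open ≡-Reasoning
      open IsPairingOn pairing
      rest = remove (q a) xs
      in-rest : ∀ {b} → b ∈ rest → b ∈ a ∷ xs
      in-rest = there ∘ proj₁ ∘ ∈-remove⁻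
      -- q pairs a with q a, hence maps no other element to either of them.
      closed-rest : ∀ {b} → b ∈ xs → b ≢ q a → q b ∈ a ∷ xs → q b ∈ rest
      closed-rest b∈xs b≢qa (here qb≡a) =
        ⊥-elim (b≢qa (trans (sym (involutive (there b∈xs))) (cong q qb≡a)))
      closed-rest b∈xs _ (there qb∈xs) = ∈-remove⁺ qb∈xs λ qb≡qa →
        All.lookup a∉xs (subst (_∈ xs) (b≡a b∈xs qb≡qa) b∈xs) refl
        where
        b≡a : ∀ {b} → b ∈ xs → q b ≡ q a → b ≡ a
        b≡a {b} b∈xs qb≡qa = begin
          b         ≡⟨ involutive (there b∈xs) ⟨
          q (q b)   ≡⟨ cong q qb≡qa ⟩
          q (q a)   ≡⟨ involutive (here refl) ⟩
          a         ∎
      rest-pairing : IsPairingOn q rest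
      rest-pairing = record
        { closed         = λ b∈rest → let b∈xs , b≢qa = ∈-remove⁻ b∈rest in
                             closed-rest b∈xs b≢qa (closed (there b∈xs))
        ; involutive     = involutive ∘ in-rest
        ; no-fixed-point = no-fixed-point ∘ in-rest }
      len-rest : length rest ≤ s
      len-rest = ℕₚ.≤-trans (ℕₚ.n≤1+n _) (subst (_≤ s) (length-remove xs-unique qa∈xs) len)
      rest-even : ∃[ k ] length rest ≡ 2 * k
      rest-even = bounded s len-rest (remove-unique (q a) xs-unique) rest-pairing
      k = proj₁ rest-even
      k-even = proj₂ rest-even

allPairs-lookup : ∀ {A : Set} {R : A → A → Set} → (∀ {x y} → R x y → R y x) →
  ∀ {xs} → AllPairs R xs → ∀ i j → i ≢ j → R (List.lookup xs i) (List.lookup xs j)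
allPairs-lookup R-sym (_ ∷ _)    zero    zero    i≢j = ⊥-elim (i≢j refl)
allPairs-lookup R-sym (Rx ∷ _)   zero    (suc j) _   = All.lookup Rx (∈-lookup j)
allPairs-lookup R-sym (Rx ∷ _)   (suc i) zero    _   = R-sym (All.lookup Rx (∈-lookup i))
allPairs-lookup R-sym (_ ∷ Rxs)  (suc i) (suc j) i≢j = allPairs-lookup R-sym Rxs i j (i≢j ∘ cong suc)

unique⇒allPairs : ∀ {A : Set} {P : A → Set} {R : A → A → Set} →
  (∀ {x y} → P x → P y → x ≢ y → R x y) → ∀ {xs} → All P xs → Unique xs → AllPairs R xs
unique⇒allPairs R-distinct All.[] AllPairs.[] = AllPairs.[]
unique⇒allPairs R-distinct (Px All.∷ Pxs) (x∉xs ∷ xs-unique) =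
  All.zipWith (λ (Py , x≢y) → R-distinct Px Py x≢y) (Pxs , x∉xs) ∷ unique⇒allPairs R-distinct Pxs xs-unique

lookup-extensionality : ∀ {N} {u v : Word N} → (∀ p → lookup u p ≡ lookup v p) → u ≡ v
lookup-extensionality {u = u} {v} u≗v =
  trans (sym (tabulate∘lookup u)) (trans (tabulate-cong u≗v) (tabulate∘lookup v))

infix 4 _≟ʷ_
_≟ʷ_ : ∀ {N} → DecidableEquality (Word N)
_≟ʷ_ = ≡-dec Finₚ._≟_

isPerm? : ∀ {N} (v : Word N) → Dec (IsPerm v)
isPerm? v = Finₚ.all? λ i → Finₚ.all? λ j → (lookup v i Finₚ.≟ lookup v j) →-dec (i Finₚ.≟ j)

other : ∀ {N} → Word N → Pair N → Word N
other w (u , v) with w ≟ʷ u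
... | yes _ = v
... | no  _ = u

other-ˡ : ∀ {N} (u v : Word N) → other u (u , v) ≡ v
other-ˡ u v with u ≟ʷ u
... | yes _   = refl
... | no  u≢u = ⊥-elim (u≢u refl)

other-ʳ : ∀ {N} {u v : Word N} → u ≢ v → other v (u , v) ≡ u
other-ʳ {u = u} {v} u≢v with v ≟ʷ u
... | yes v≡u = ⊥-elim (u≢v (sym v≡u))
... | no  _   = refl

other-involution : ∀ {N} {w u v : Word N} → u ≢ v → Incident w (u , v) →
  Incident (other w (u , v)) (u , v) × other w (u , v) ≢ w × other (other w (u , v)) (u , v) ≡ w
other-involution {u = u} {v} u≢v (inj₁ refl)
  rewrite other-ˡ u v | other-ʳ u≢v = inj₂ refl , u≢v ∘ sym , refl
other-involution {u = u} {v} u≢v (inj₂ refl)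
  rewrite other-ʳ u≢v | other-ˡ u v = inj₁ refl , u≢v , refl

vectors : ∀ N k → List (Vec (Fin N) k)
vectors N zero    = [] ∷ []
vectors N (suc k) = cartesianProductWith _∷_ (allFin N) (vectors N k)

∈-vectors : ∀ {N k} (v : Vec (Fin N) k) → v ∈ vectors N k
∈-vectors []      = here refl
∈-vectors (a ∷ v) = ∈-cartesianProductWith⁺ _∷_ (∈-allFin a) (∈-vectors v)

vectors-unique : ∀ N k → Unique (vectors N k)
vectors-unique N zero    = All.[] ∷ AllPairs.[]
vectors-unique N (suc k) = cartesianProductWith⁺ _∷_ ∷-injective (allFin⁺ N) (vectors-unique N k)

permutations : ∀ N → List (Word N)
permutations N = filter isPerm? (vectors N N)

∈-permutations⁺ : ∀ {N} {v : Word N} → IsPerm v → v ∈ permutations N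
∈-permutations⁺ = ∈-filter⁺ isPerm? (∈-vectors _)

∈-permutations⁻ : ∀ {N} {v : Word N} → v ∈ permutations N → IsPerm v
∈-permutations⁻ {N} = proj₂ ∘ ∈-filter⁻ isPerm? {xs = vectors N N}

permutations-unique : ∀ N → Unique (permutations N)
permutations-unique N = filter⁺ isPerm? (vectors-unique N N)

identity : ∀ {N} → Word N
identity = tabulate (λ i → i)

identity-perm : ∀ {N} → IsPerm (identity {N})
identity-perm i j eq = trans (sym (lookup∘tabulate _ i)) (trans eq (lookup∘tabulate _ j))

-- Perfect matchings from fixed-point-free involutions

module _ {n : ℕ} (F : List (Pair (suc n))) where

  record PerfectPairing : Set where
    field
      partner            : Word (suc n) → Word (suc n)
      partner-perm       : ∀ {v} → IsPerm v → IsPerm (partner v)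
      partner-involutive : ∀ {v} → IsPerm v → partner (partner v) ≡ v
      partner-≢          : ∀ {v} → IsPerm v → partner v ≢ v
      partner-adjacent   : ∀ {v} → IsPerm v → Adj v (partner v)
      partner-∉          : ∀ {v} → IsPerm v → ¬ ((v , partner v) ∈E F)

  Disjoint : Pair (suc n) → Pair (suc n) → Set
  Disjoint e e′ = ∀ w → Incident w e → ¬ Incident w e′

  perfectPairing⇒perfectMatching : PerfectPairing → ∃ (IsPerfectMatchingIn F)
  perfectPairing⇒perfectMatching pairing = M , (M-edges , M-disjoint) , M-covers
    where
    open PerfectPairing pairing
    open StrictTotalOrder (Lex.<-strictTotalOrder (Finₚ.<-strictTotalOrder (suc n)) (suc n))
      using (_<_; _<?_; compare; asym)

    -- The edge {v, partner v} is listed once, from its lexicographically smaller end.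
    Leader : Word (suc n) → Set
    Leader v = IsPerm v × v < partner v

    leader? : ∀ v → Dec (Leader v)
    leader? v = isPerm? v ×-dec (v <? partner v)

    leaders : List (Word (suc n))
    leaders = filter leader? (permutations (suc n))

    all-leaders : All Leader leaders
    all-leaders = Allₚ.all-filter leader? (permutations (suc n))

    edge : Word (suc n) → Pair (suc n)
    edge v = v , partner v

    M : List (Pair (suc n))
    M = map edge leaders

    M-edges : All (λ e → IsEdge e × ¬ (e ∈E F)) M
    M-edges = Allₚ.map⁺ (All.map (λ (v-perm , _) →
      (v-perm , partner-perm v-perm , partner-adjacent v-perm) , partner-∉ v-perm) all-leaders)

    leaders-disjoint : ∀ {x y} → Leader x → Leader y → x ≢ y → Disjoint (edge x) (edge y)
    leaders-disjoint _ _ x≢y w (inj₁ w≡x) (inj₁ w≡y) = x≢y (trans (sym w≡x) w≡y)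
    leaders-disjoint {x} {y} (x-perm , x<px) (y-perm , y<py) x≢y w (inj₁ w≡x) (inj₂ w≡py) =
      asym y<py (subst₂ _<_ x≡py (trans (cong partner x≡py) (partner-involutive y-perm)) x<px)
      where x≡py = trans (sym w≡x) w≡py
    leaders-disjoint {x} {y} (x-perm , x<px) (y-perm , y<py) x≢y w (inj₂ w≡px) (inj₁ w≡y) =
      asym x<px (subst₂ _<_ y≡px (trans (cong partner y≡px) (partner-involutive x-perm)) y<py)
      where y≡px = trans (sym w≡y) w≡px
    leaders-disjoint {x} {y} (x-perm , _) (y-perm , _) x≢y w (inj₂ w≡px) (inj₂ w≡py) = x≢y (begin
      x                   ≡⟨ partner-involutive x-perm ⟨
      partner (partner x) ≡⟨ cong partner (trans (sym w≡px) w≡py) ⟩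
      partner (partner y) ≡⟨ partner-involutive y-perm ⟩
      y                   ∎)
      where open ≡-Reasoning

    M-disjoint : ∀ i j → i ≢ j → Disjoint (List.lookup M i) (List.lookup M j)
    M-disjoint = allPairs-lookup {R = Disjoint} (λ d w a b → d w b a)
      (AllPairsₚ.map⁺ (unique⇒allPairs leaders-disjoint all-leaders
        (filter⁺ leader? (permutations-unique (suc n)))))

    covers-leader : ∀ {v w} → Leader v → Incident w (edge v) → Covers M w
    covers-leader {v} {w} v-leader w∈e = Any.map (λ e≡ → subst (Incident w) e≡ w∈e)
      (∈-map⁺ edge (∈-filter⁺ leader? (∈-permutations⁺ (proj₁ v-leader)) v-leader))

    M-covers : ∀ w → IsPerm w → Covers M w
    M-covers w w-perm with compare w (partner w)
    ... | tri< w<pw _ _ = covers-leader (w-perm , w<pw) (inj₁ refl)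
    ... | tri≈ _ w≋pw _ = ⊥-elim (partner-≢ w-perm (sym (Pointwise-≡⇒≡ w≋pw)))
    ... | tri> _ _ pw<w = covers-leader
      (partner-perm w-perm , subst (partner w <_) (sym (partner-involutive w-perm)) pw<w)
      (inj₂ (sym (partner-involutive w-perm)))

-- The bubble-sort star graph

module BubbleSortStar (m : ℕ) where

  -- inj₁ i is the transposition ⟨1, i+2⟩ and inj₂ k the transposition ⟨k+2, k+3⟩ of the paper.
  Gen : Set
  Gen = Fin (suc m) ⊎ Fin m

  V : Set
  V = Word (suc (suc m))

  lo hi : Gen → Fin (suc (suc m))
  lo (inj₁ _) = zero
  lo (inj₂ k) = inject₁ (suc k)
  hi (inj₁ i) = suc i
  hi (inj₂ k) = suc (suc k)

  lo<hi : ∀ g → lo g Fin.< hi g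
  lo<hi (inj₁ _) = s≤s z≤n
  lo<hi (inj₂ k) = inject₁<suc (suc k)

  τ : Gen → Fin (suc (suc m)) → Fin (suc (suc m))
  τ g = transpose (lo g) (hi g)

  infixl 7 _·_
  _·_ : V → Gen → V
  y · g = swapPos y (lo g) (hi g)

  lookup-· : ∀ y g p → lookup (y · g) p ≡ lookup y (τ g p)
  lookup-· y g = lookup∘tabulate (lookup y ∘ τ g)

  τ-lo : ∀ g → τ g (lo g) ≡ hi g
  τ-lo g = transpose-matchˡ (lo g) (hi g)

  τ-hi : ∀ g → τ g (hi g) ≡ lo g
  τ-hi g = transpose-matchʳ (lo g) (hi g)

  τ-fixes : ∀ g p → p ≢ lo g → p ≢ hi g → τ g p ≡ p
  τ-fixes g p = transpose-mismatch {i = lo g} {hi g} {p}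

  τ-involutive : ∀ g p → τ g (τ g p) ≡ p
  τ-involutive g = transpose-involutive (lo g) (hi g)

  τ-injective : ∀ g → Injective _≡_ _≡_ (τ g)
  τ-injective g {p} {q} eq = trans (sym (τ-involutive g p)) (trans (cong (τ g) eq) (τ-involutive g q))

  ·-involutive : ∀ y g → y · g · g ≡ y
  ·-involutive y g = lookup-extensionality λ p → begin
    lookup (y · g · g) p   ≡⟨ lookup-· (y · g) g p ⟩
    lookup (y · g) (τ g p) ≡⟨ lookup-· y g (τ g p) ⟩
    lookup y (τ g (τ g p)) ≡⟨ cong (lookup y) (τ-involutive g p) ⟩
    lookup y p             ∎
    where open ≡-Reasoning

  ·-transpose : ∀ {y z} g → y · g ≡ z → y ≡ z · g
  ·-transpose {y} g refl = sym (·-involutive y g)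

  ·-perm : ∀ y g → IsPerm y → IsPerm (y · g)
  ·-perm y g y-perm i j eq =
    τ-injective g (y-perm _ _ (trans (sym (lookup-· y g i)) (trans eq (lookup-· y g j))))

  ·-≢ : ∀ y g → IsPerm y → y · g ≢ y
  ·-≢ y g y-perm eq = Finₚ.<⇒≢ (lo<hi g) (y-perm _ _ (begin
    lookup y (lo g)             ≡⟨ cong (lookup y) (τ-hi g) ⟨
    lookup y (τ g (hi g))       ≡⟨ lookup-· y g (hi g) ⟨
    lookup (y · g) (hi g)       ≡⟨ cong (λ z → lookup z (hi g)) eq ⟩
    lookup y (hi g)             ∎))
    where open ≡-Reasoning

  lo-hi-injective : ∀ {g h} → lo g ≡ lo h → hi g ≡ hi h → g ≡ h
  lo-hi-injective {inj₁ _} {inj₁ _} _  hi≡ = cong inj₁ (Finₚ.suc-injective hi≡)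
  lo-hi-injective {inj₂ _} {inj₂ _} _  hi≡ = cong inj₂ (Finₚ.suc-injective (Finₚ.suc-injective hi≡))
  lo-hi-injective {inj₁ _} {inj₂ _} () _
  lo-hi-injective {inj₂ _} {inj₁ _} () _

  ·-cancelˡ : ∀ y g h → IsPerm y → y · g ≡ y · h → g ≡ h
  ·-cancelˡ y g h y-perm eq = same-support (transpose-support (Finₚ.<⇒≢ (lo<hi g)) τg≗τh)
    where
    τg≗τh : ∀ p → τ g p ≡ τ h p
    τg≗τh p = y-perm _ _ (trans (sym (lookup-· y g p)) (trans (cong (λ z → lookup z p) eq) (lookup-· y h p)))
    same-support : (lo g ≡ lo h × hi g ≡ hi h) ⊎ (lo g ≡ hi h × hi g ≡ lo h) → g ≡ h
    same-support (inj₁ (lo≡ , hi≡)) = lo-hi-injective lo≡ hi≡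
    same-support (inj₂ (lo≡ , hi≡)) = ⊥-elim (Finₚ.<-asym (lo<hi g) (subst₂ Fin._<_ (sym hi≡) (sym lo≡) (lo<hi h)))

  ·-adjacent : ∀ y g → Adj (y · g) y
  ·-adjacent y (inj₁ i) = inj₁ (suc i , (λ ()) , refl)
  ·-adjacent y (inj₂ k) = inj₂ (suc k , s≤s z≤n , refl)

  adjacent-· : ∀ y g → Adj y (y · g)
  adjacent-· y g = subst (λ z → Adj z (y · g)) (·-involutive y g) (·-adjacent (y · g) g)

  adjacent⇒· : ∀ {u v} → Adj u v → ∃[ g ] u ≡ v · g
  adjacent⇒· (inj₁ (zero  , 0≢0 , _)) = ⊥-elim (0≢0 refl)
  adjacent⇒· (inj₁ (suc i , _   , u≡)) = inj₁ i , u≡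
  adjacent⇒· (inj₂ (zero  , ()  , _))
  adjacent⇒· (inj₂ (suc k , _   , u≡)) = inj₂ k , u≡

  -- If s carries the support of t onto that of u, then u = s t s and y, y·s, y·s·t = y·u·s, y·u is a 4-cycle.
  ·-square : ∀ s t u → τ s (lo t) ≡ lo u → τ s (hi t) ≡ hi u → ∀ y → y · u · s ≡ y · s · t
  ·-square s t u lo≡ hi≡ y = lookup-extensionality λ p → begin
    lookup (y · u · s) p                                   ≡⟨ lookup-· (y · u) s p ⟩
    lookup (y · u) (τ s p)                                 ≡⟨ lookup-· y u (τ s p) ⟩
    lookup y (transpose (lo u) (hi u) (τ s p))             ≡⟨ cong₂ (λ a b → lookup y (transpose a b (τ s p))) lo≡ hi≡ ⟨
    lookup y (transpose (τ s (lo t)) (τ s (hi t)) (τ s p)) ≡⟨ cong (lookup y) (conjugate p) ⟨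
    lookup y (τ s (τ t p))                                 ≡⟨ lookup-· y s (τ t p) ⟨
    lookup (y · s) (τ t p)                                 ≡⟨ lookup-· (y · s) t p ⟨
    lookup (y · s · t) p                                   ∎
    where
    open ≡-Reasoning
    conjugate : ∀ p → τ s (τ t p) ≡ transpose (τ s (lo t)) (τ s (hi t)) (τ s p)
    conjugate = transpose-conjugate (τ s) (τ-injective s) (lo t) (hi t)

  degree : ℕ
  degree = suc m + m

  toFin : Gen → Fin degree
  toFin = join (suc m) m

  fromFin : Fin degree → Gen
  fromFin = splitAt (suc m)

  toFin-fromFin : ∀ i → toFin (fromFin i) ≡ i
  toFin-fromFin = Finₚ.join-splitAt (suc m) m

  gens : List Gen
  gens = map fromFin (allFin degree)

  ∈-gens : ∀ g → g ∈ gens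
  ∈-gens g = subst (_∈ gens) (Finₚ.splitAt-join (suc m) m g) (∈-map⁺ fromFin (∈-allFin (toFin g)))

  gens-unique : Unique gens
  gens-unique = map⁺ (λ {i} {j} eq → trans (sym (toFin-fromFin i)) (trans (cong toFin eq) (toFin-fromFin j)))
                     (allFin⁺ degree)

  length-gens : length gens ≡ degree
  length-gens = trans (Listₚ.length-map fromFin (allFin degree)) (Listₚ.length-tabulate (λ i → i))

  edge-≢ : ∀ {u v} → IsEdge (u , v) → u ≢ v
  edge-≢ {u} {v} (_ , v-perm , u~v) u≡v with adjacent⇒· {u} {v} u~v
  ... | g , u≡vg = ·-≢ v g v-perm (trans (sym u≡vg) u≡v)

  permutations-even : ∃[ k ] length (permutations (suc (suc m))) ≡ 2 * k
  permutations-even = pairing⇒even _≟ʷ_ (permutations-unique _) record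
    { closed         = λ {v} v∈ →
                         ∈-permutations⁺ {v = v · inj₁ zero} (·-perm v (inj₁ zero) (∈-permutations⁻ v∈))
    ; involutive     = λ {v} _ → ·-involutive v (inj₁ zero)
    ; no-fixed-point = λ {v} v∈ → ·-≢ v (inj₁ zero) (∈-permutations⁻ v∈) }

  module Mate {F M : List (Pair (suc (suc m)))} (M-matching : IsMatchingIn F M) where

    M-edge : ∀ i → IsEdge (List.lookup M i)
    M-edge i = proj₁ (All.lookup (proj₁ M-matching) (∈-lookup i))

    covers-at : ∀ {w} i → Incident w (List.lookup M i) → Covers M w
    covers-at {w} i w∈eᵢ = Any.map (λ eᵢ≡ → subst (Incident w) eᵢ≡ w∈eᵢ) (∈-lookup i)

    mate : V → V
    mate w with Any.any? (λ (u , v) → (w ≟ʷ u) ⊎-dec (w ≟ʷ v)) M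
    ... | yes w∈M = other w (Any.lookup w∈M)
    ... | no  _   = w

    mate-at : ∀ {w} i → Incident w (List.lookup M i) → mate w ≡ other w (List.lookup M i)
    mate-at {w} i w∈eᵢ with Any.any? (λ (u , v) → (w ≟ʷ u) ⊎-dec (w ≟ʷ v)) M
    ... | no w∉M = ⊥-elim (w∉M (covers-at i w∈eᵢ))
    ... | yes w∈M with Any.index w∈M Finₚ.≟ i
    ...   | yes refl = refl
    ...   | no  j≢i  = ⊥-elim (proj₂ M-matching _ i j≢i w (Anyₚ.lookup-index w∈M) w∈eᵢ)

    module _ {w} (w-covered : Covers M w) where
      private
        i = Any.index w-covered
        e = List.lookup M i
        w∈e : Incident w e
        w∈e = Anyₚ.lookup-index w-covered
        mate≡ : mate w ≡ other w e
        mate≡ = mate-at i w∈e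
        swap = other-involution (edge-≢ (M-edge i)) w∈e
        mate∈e : Incident (mate w) e
        mate∈e = subst (λ z → Incident z e) (sym mate≡) (proj₁ swap)

      mate-covered : Covers M (mate w)
      mate-covered = covers-at i mate∈e

      mate-perm : IsPerm (mate w)
      mate-perm with mate∈e
      ... | inj₁ mate≡u = subst IsPerm (sym mate≡u) (proj₁ (M-edge i))
      ... | inj₂ mate≡v = subst IsPerm (sym mate≡v) (proj₁ (proj₂ (M-edge i)))

      mate-≢ : mate w ≢ w
      mate-≢ = subst (_≢ w) (sym mate≡) (proj₁ (proj₂ swap))

      mate-involutive : mate (mate w) ≡ w
      mate-involutive = begin
        mate (mate w)       ≡⟨ mate-at i mate∈e ⟩
        other (mate w) e    ≡⟨ cong (λ z → other z e) mate≡ ⟩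
        other (other w e) e ≡⟨ proj₂ (proj₂ swap) ⟩
        w                   ∎
        where open ≡-Reasoning

  ¬almostPerfect : ∀ {F} → ¬ ∃ (IsAlmostPerfectMatchingIn F)
  ¬almostPerfect (M , M-matching , x , x-perm , x-uncovered , covers) = ℕₚ.even≢odd k j (begin
    2 * k                  ≡⟨ k-even ⟨
    length perms           ≡⟨ length-remove _≟ʷ_ (permutations-unique _) (∈-permutations⁺ x-perm) ⟩
    suc (length rest)      ≡⟨ cong suc j-even ⟩
    suc (2 * j)            ∎)
    where
    open ≡-Reasoning
    open Mate M-matching
    perms = permutations (suc (suc m))
    rest = remove _≟ʷ_ x perms
    k = proj₁ permutations-even
    k-even = proj₂ permutations-even
    rest-covered : ∀ {y} → y ∈ rest → Covers M y
    rest-covered y∈ = let y∈perms , y≢x = ∈-remove⁻ _≟ʷ_ y∈ in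
      covers _ (∈-permutations⁻ y∈perms) y≢x
    rest-pairing : IsPairingOn _≟ʷ_ mate rest
    rest-pairing = record
      { closed         = λ {y} y∈ →
          ∈-remove⁺ _≟ʷ_ (∈-permutations⁺ {v = mate y} (mate-perm (rest-covered y∈)))
            λ mate≡x → x-uncovered (subst (Covers M) mate≡x (mate-covered (rest-covered y∈)))
      ; involutive     = mate-involutive ∘ rest-covered
      ; no-fixed-point = mate-≢ ∘ rest-covered }
    rest-even = pairing⇒even _≟ʷ_ (remove-unique _≟ʷ_ x (permutations-unique _)) rest-pairing
    j = proj₁ rest-even
    j-even = proj₂ rest-even

  star : V → List (Pair (suc (suc m)))
  star y = map (λ g → y , y · g) gens

  length-star : ∀ y → length (star y) ≡ degree
  length-star y = trans (Listₚ.length-map _ gens) length-gens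

  ∈E-star : ∀ {y e} g → SameEdge e (y , y · g) → e ∈E star y
  ∈E-star {y} {e} g e≈yg =
    Any.map (λ yg≡ → subst (SameEdge e) yg≡ e≈yg) (∈-map⁺ (λ g → y , y · g) (∈-gens g))

  star-isEdgeSet : ∀ {y} → IsPerm y → IsEdgeSet (star y)
  star-isEdgeSet {y} y-perm =
    Allₚ.map⁺ (All.universal (λ g → y-perm , ·-perm y g y-perm , adjacent-· y g) gens) ,
    allPairs-lookup {R = λ e e′ → ¬ SameEdge e e′} (λ ¬same → ¬same ∘ sameEdge-sym)
      (AllPairsₚ.map⁺ (AllPairs.map distinct-edges gens-unique))
    where
    sameEdge-sym : ∀ {e e′ : Pair (suc (suc m))} → SameEdge e e′ → SameEdge e′ e
    sameEdge-sym (inj₁ (u≡ , v≡)) = inj₁ (sym u≡ , sym v≡)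
    sameEdge-sym (inj₂ (u≡ , v≡)) = inj₂ (sym v≡ , sym u≡)
    distinct-edges : ∀ {g h} → g ≢ h → ¬ SameEdge (y , y · g) (y , y · h)
    distinct-edges {g} {h} g≢h (inj₁ (_ , yg≡yh)) = g≢h (·-cancelˡ y g h y-perm yg≡yh)
    distinct-edges {g} {h} g≢h (inj₂ (y≡yh , _))  = ·-≢ y h y-perm (sym y≡yh)

  edge-class-at : ∀ {y e} → IsEdge e → Incident y e → ∃[ g ] SameEdge e (y , y · g)
  edge-class-at {y} {u , v} (_ , _ , u~v) y∈e = g , at y∈e
    where
    g = proj₁ (adjacent⇒· {u} {v} u~v)
    u≡vg = proj₂ (adjacent⇒· {u} {v} u~v)
    at : Incident y (u , v) → SameEdge (u , v) (y , y · g)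
    at (inj₁ y≡u) = inj₁ (sym y≡u , trans (·-transpose g (sym u≡vg)) (cong (_· g) (sym y≡u)))
    at (inj₂ y≡v) = inj₂ (trans u≡vg (cong (_· g) (sym y≡v)) , sym y≡v)

  star-uncovered : ∀ {y} M → IsMatchingIn (star y) M → ¬ Covers M y
  star-uncovered {y} M (M-edges , _) y-covered = e∉star (∈E-star g same)
    where
    i = Any.index y-covered
    e-edge = proj₁ (All.lookup M-edges (∈-lookup i))
    e∉star = proj₂ (All.lookup M-edges (∈-lookup i))
    g = proj₁ (edge-class-at e-edge (Anyₚ.lookup-index y-covered))
    same = proj₂ (edge-class-at e-edge (Anyₚ.lookup-index y-covered))

  star-isMPS : ∀ {y} → IsPerm y → IsMatchingPreclusionSet (star y)
  star-isMPS {y} y-perm =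
    star-isEdgeSet y-perm ,
    (λ (M , M-matching , covers) → star-uncovered M M-matching (covers y y-perm)) ,
    ¬almostPerfect

  generatorPairing : ∀ {F} (r : V → Gen) → (∀ v → r (v · r v) ≡ r v) →
    (∀ {v} → IsPerm v → ¬ ((v , v · r v) ∈E F)) → PerfectPairing F
  generatorPairing r r-stable ∉F = record
    { partner            = λ v → v · r v
    ; partner-perm       = λ {v} v-perm → ·-perm v (r v) v-perm
    ; partner-involutive = λ {v} _ → trans (cong (v · r v ·_) (r-stable v)) (·-involutive v (r v))
    ; partner-≢          = λ {v} v-perm → ·-≢ v (r v) v-perm
    ; partner-adjacent   = λ {v} _ → adjacent-· v (r v)
    ; partner-∉          = ∉F }

  -- The 4-cycle x, x·s, x·s·t = x·u·s, x·u: trade its two s-edges for its u-edge and its t-edge.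
  module Switch (s t u : Gen) (x : V) (x-perm : IsPerm x) (s≢t : s ≢ t) (s≢u : s ≢ u)
                (square : ∀ y → y · u · s ≡ y · s · t) where

    OnU OnT : V → Set
    OnU v = v ≡ x ⊎ v ≡ x · u
    OnT v = v ≡ x · s ⊎ v ≡ x · s · t

    ¬OnU×OnT : ∀ {v} → OnU v → OnT v → ⊥
    ¬OnU×OnT (inj₁ refl) (inj₁ x≡xs)   = ·-≢ x s x-perm (sym x≡xs)
    ¬OnU×OnT (inj₁ refl) (inj₂ x≡xst)  = s≢t (·-cancelˡ x s t x-perm (·-transpose t (sym x≡xst)))
    ¬OnU×OnT (inj₂ refl) (inj₁ xu≡xs)  = s≢u (sym (·-cancelˡ x u s x-perm xu≡xs))
    ¬OnU×OnT (inj₂ refl) (inj₂ xu≡xst) = ·-≢ (x · u) s (·-perm x u x-perm) (trans (square x) (sym xu≡xst))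

    OnU-closed : ∀ {v} → OnU v → OnU (v · u)
    OnU-closed (inj₁ refl) = inj₂ refl
    OnU-closed (inj₂ refl) = inj₁ (·-involutive x u)

    OnT-closed : ∀ {v} → OnT v → OnT (v · t)
    OnT-closed (inj₁ refl) = inj₂ refl
    OnT-closed (inj₂ refl) = inj₁ (·-involutive (x · s) t)

    ¬OnU-· : ∀ {v} → ¬ OnU v → ¬ OnT v → ¬ OnU (v · s)
    ¬OnU-· _ ¬T (inj₁ vs≡x)  = ¬T (inj₁ (·-transpose s vs≡x))
    ¬OnU-· _ ¬T (inj₂ vs≡xu) = ¬T (inj₂ (trans (·-transpose s vs≡xu) (square x)))

    ¬OnT-· : ∀ {v} → ¬ OnU v → ¬ OnT v → ¬ OnT (v · s)
    ¬OnT-· ¬U _ (inj₁ vs≡xs)  = ¬U (inj₁ (trans (·-transpose s vs≡xs) (·-involutive x s)))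
    ¬OnT-· ¬U _ (inj₂ vs≡xst) = ¬U (inj₂ (trans (·-transpose s vs≡xst) (sym (·-transpose s (square x)))))

    RungCases : V → Gen → Set
    RungCases v g = (OnU v × g ≡ u) ⊎ (¬ OnU v × OnT v × g ≡ t) ⊎ (¬ OnU v × ¬ OnT v × g ≡ s)

    OnU? : ∀ v → Dec (OnU v)
    OnU? v = (v ≟ʷ x) ⊎-dec (v ≟ʷ x · u)

    OnT? : ∀ v → Dec (OnT v)
    OnT? v = (v ≟ʷ x · s) ⊎-dec (v ≟ʷ x · s · t)

    rung-from : ∀ {v} → Dec (OnU v) → Dec (OnT v) → Σ Gen (RungCases v)
    rung-from (yes U)  _       = u , inj₁ (U , refl)
    rung-from (no ¬U) (yes T) = t , inj₂ (inj₁ (¬U , T , refl))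
    rung-from (no ¬U) (no ¬T) = s , inj₂ (inj₂ (¬U , ¬T , refl))

    -- Opaque, since unfolding rung into the word comparisons makes type checking very slow.
    opaque
      rung : V → Gen
      rung v = proj₁ (rung-from (OnU? v) (OnT? v))

      rung-cases : ∀ v → RungCases v (rung v)
      rung-cases v = proj₂ (rung-from (OnU? v) (OnT? v))

    rung-stable : ∀ v → rung (v · rung v) ≡ rung v
    rung-stable v with rung-cases v
    ... | inj₁ (U , r≡u) rewrite r≡u with rung-cases (v · u)
    ...   | inj₁ (_ , eq)             = eq
    ...   | inj₂ (inj₁ (¬U′ , _))     = ⊥-elim (¬U′ (OnU-closed U))
    ...   | inj₂ (inj₂ (¬U′ , _))     = ⊥-elim (¬U′ (OnU-closed U))
    rung-stable v | inj₂ (inj₁ (_ , T , r≡t)) rewrite r≡t with rung-cases (v · t)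
    ...   | inj₁ (U′ , _)             = ⊥-elim (¬OnU×OnT U′ (OnT-closed T))
    ...   | inj₂ (inj₁ (_ , _ , eq))  = eq
    ...   | inj₂ (inj₂ (_ , ¬T′ , _)) = ⊥-elim (¬T′ (OnT-closed T))
    rung-stable v | inj₂ (inj₂ (¬U , ¬T , r≡s)) rewrite r≡s with rung-cases (v · s)
    ...   | inj₁ (U′ , _)             = ⊥-elim (¬OnU-· ¬U ¬T U′)
    ...   | inj₂ (inj₁ (_ , T′ , _))  = ⊥-elim (¬OnT-· ¬U ¬T T′)
    ...   | inj₂ (inj₂ (_ , _ , eq))  = eq

-- Matching preclusion sets of size at most the degree

module SmallPreclusionSet (m : ℕ) (F : List (Pair (suc (suc (suc m))))) (F-edges : All IsEdge F)
                          (no-perfect : ¬ ∃ (IsPerfectMatchingIn F))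
                          (small : length F ≤ BubbleSortStar.degree (suc m)) where

  open BubbleSortStar (suc m)

  InF : Gen → V → Set
  InF g y = (y , y · g) ∈E F

  InF? : ∀ g y → Dec (InF g y)
  InF? g y = Any.any? (λ (u , v) → ((y ≟ʷ u) ×-dec (y · g ≟ʷ v)) ⊎-dec ((y ≟ʷ v) ×-dec (y · g ≟ʷ u)))
                      F

  InF-· : ∀ g y → InF g y → InF g (y · g)
  InF-· g y = Any.map λ where
    (inj₁ (y≡u , yg≡v)) → inj₂ (yg≡v , trans (·-involutive y g) y≡u)
    (inj₂ (y≡v , yg≡u)) → inj₁ (yg≡u , trans (·-involutive y g) y≡v)

  InF-sym : ∀ g y → InF g (y · g) → InF g y
  InF-sym g y hit = subst (InF g) (·-involutive y g) (InF-· g (y · g) hit)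

  sameEdge-· : ∀ {g y z e} → SameEdge (y , y · g) e → SameEdge (z , z · g) e → z ≡ y ⊎ z ≡ y · g
  sameEdge-· (inj₁ (y≡ , _))  (inj₁ (z≡ , _))  = inj₁ (trans z≡ (sym y≡))
  sameEdge-· (inj₁ (_ , yg≡)) (inj₂ (z≡ , _))  = inj₂ (trans z≡ (sym yg≡))
  sameEdge-· (inj₂ (_ , yg≡)) (inj₁ (z≡ , _))  = inj₂ (trans z≡ (sym yg≡))
  sameEdge-· (inj₂ (y≡ , _))  (inj₂ (z≡ , _))  = inj₁ (trans z≡ (sym y≡))

  InClass : Gen → Pair (suc (suc (suc m))) → Set
  InClass g (u , v) = u ≡ v · g

  sameEdge⇒InClass : ∀ {g} y {e} → SameEdge (y , y · g) e → InClass g e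
  sameEdge⇒InClass {g} y (inj₁ (refl , refl)) = sym (·-involutive y g)
  sameEdge⇒InClass     y (inj₂ (refl , refl)) = refl

  F-edge : ∀ i → IsEdge (List.lookup F i)
  F-edge i = All.lookup F-edges (∈-lookup i)

  classify : ∀ i → Σ Gen λ g → InClass g (List.lookup F i)
  classify i = adjacent⇒· {proj₁ (List.lookup F i)} {proj₂ (List.lookup F i)} (proj₂ (proj₂ (F-edge i)))

  class : Fin (length F) → Gen
  class = proj₁ ∘ classify

  class-unique : ∀ i g → InClass g (List.lookup F i) → class i ≡ g
  class-unique i g in-g = ·-cancelˡ (proj₂ (List.lookup F i)) (class i) g (proj₁ (proj₂ (F-edge i)))
    (trans (sym (proj₂ (classify i))) in-g)

  every-class-hit : ∀ g → Any (InClass g) F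
  every-class-hit g with Any.any? (λ (u , v) → u ≟ʷ v · g) F
  ... | yes hit = hit
  ... | no  ¬hit = ⊥-elim (no-perfect (perfectPairing⇒perfectMatching F
        (generatorPairing (λ _ → g) (λ _ → refl)
          λ {v} _ v∈F → ¬hit (Any.map (sameEdge⇒InClass {g} v) v∈F))))

  -- With one edge of F in each of the `degree` classes and |F| ≤ degree, no class holds two edges.
  class-injective : Injective _≡_ _≡_ class
  class-injective = retraction⇒injective (toFin ∘ class) (Any.index ∘ every-class-hit ∘ fromFin) section small
                  ∘ cong toFin
    where
    section : ∀ i → toFin (class (Any.index (every-class-hit (fromFin i)))) ≡ i
    section i = trans (cong toFin (class-unique _ (fromFin i) (Anyₚ.lookup-index (every-class-hit (fromFin i)))))
                      (toFin-fromFin i)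

  InF-unique : ∀ g y z → InF g y → InF g z → z ≡ y ⊎ z ≡ y · g
  InF-unique g y z y-hit z-hit = sameEdge-· {g} (Anyₚ.lookup-index y-hit)
    (subst (λ i → SameEdge (z , z · g) (List.lookup F i)) (sym same-index) (Anyₚ.lookup-index z-hit))
    where
    same-index : Any.index y-hit ≡ Any.index z-hit
    same-index = class-injective (trans (class-unique _ g (sameEdge⇒InClass {g} y (Anyₚ.lookup-index y-hit)))
      (sym (class-unique _ g (sameEdge⇒InClass {g} z (Anyₚ.lookup-index z-hit)))))

  switch-blocked : ∀ s t u {x} → IsPerm x → s ≢ t → s ≢ u → (∀ y → y · u · s ≡ y · s · t) →
    InF s x → InF t (x · s) ⊎ InF u x
  switch-blocked s t u {x} x-perm s≢t s≢u square x-hit with InF? t (x · s) | InF? u x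
  ... | yes xs-hit  | _          = inj₁ xs-hit
  ... | no  _       | yes x-hit′ = inj₂ x-hit′
  ... | no  ¬xs-hit | no ¬x-hit  = ⊥-elim (no-perfect (perfectPairing⇒perfectMatching F
        (generatorPairing rung rung-stable λ {v} _ → avoids v (rung-cases v))))
    where
    open Switch s t u x x-perm s≢t s≢u square
    avoids : ∀ v → RungCases v (rung v) → ¬ InF (rung v) v
    avoids v (inj₁ (inj₁ v≡x , r≡u)) hit = ¬x-hit (subst₂ InF r≡u v≡x hit)
    avoids v (inj₁ (inj₂ v≡xu , r≡u)) hit = ¬x-hit (InF-sym u x (subst₂ InF r≡u v≡xu hit))
    avoids v (inj₂ (inj₁ (_ , inj₁ v≡xs , r≡t))) hit = ¬xs-hit (subst₂ InF r≡t v≡xs hit)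
    avoids v (inj₂ (inj₁ (_ , inj₂ v≡xst , r≡t))) hit =
      ¬xs-hit (InF-sym t (x · s) (subst₂ InF r≡t v≡xst hit))
    avoids v (inj₂ (inj₂ (¬U , ¬T , r≡s))) hit =
      not-x-nor-xs (InF-unique s x v x-hit (subst (λ g → InF g v) r≡s hit))
      where
      not-x-nor-xs : v ≡ x ⊎ v ≡ x · s → ⊥
      not-x-nor-xs (inj₁ v≡x)  = ¬U (inj₁ v≡x)
      not-x-nor-xs (inj₂ v≡xs) = ¬T (inj₁ v≡xs)

  class-representative : ∀ g → ∃[ x ] IsPerm x × InF g x
  class-representative g =
    proj₂ e , proj₁ (proj₂ (F-edge i)) ,
    Any.map (λ e≡ → subst (SameEdge (proj₂ e , proj₂ e · g)) e≡ (inj₂ (refl , sym (Anyₚ.lookup-index hit))))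
            (∈-lookup i)
    where
    hit = every-class-hit g
    i = Any.index hit
    e = List.lookup F i

  sₖ tₖ uₖ : Fin (suc m) → Gen
  sₖ k = inj₁ (inject₁ k)
  tₖ k = inj₁ (suc k)
  uₖ k = inj₂ k

  sₖ≢tₖ : ∀ k → sₖ k ≢ tₖ k
  sₖ≢tₖ k eq = Finₚ.<⇒≢ (inject₁<suc k) (Finₚ.suc-injective (cong hi eq))

  Corner : Fin (suc m) → V → Set
  Corner k w = InF (sₖ k) w × InF (tₖ k) w × InF (uₖ k) w

  corner : ∀ k → ∃[ w ] IsPerm w × Corner k w
  corner k = at (proj₁ (proj₂ representative)) (proj₂ (proj₂ representative))
    where
    s = sₖ k
    t = tₖ k
    u = uₖ k
    representative = class-representative s
    c-fixed : τ s (hi t) ≡ hi t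
    c-fixed = τ-fixes s (hi t) (λ ()) (Finₚ.<⇒≢ (inject₁<suc k) ∘ sym ∘ Finₚ.suc-injective)
    at : ∀ {x} → IsPerm x → InF s x → ∃[ w ] IsPerm w × Corner k w
    at {x} x-perm x-hit = combine
      (switch-blocked s t u x-perm (sₖ≢tₖ k) (λ ()) (·-square s t u (τ-lo s) c-fixed) x-hit)
      (switch-blocked s u t x-perm (λ ()) (sₖ≢tₖ k) (·-square s u t (τ-hi s) c-fixed) x-hit)
      where
      xs-fresh : ∀ g → s ≢ g → ¬ (x · s ≡ x ⊎ x · s ≡ x · g)
      xs-fresh g s≢g (inj₁ xs≡x)  = ·-≢ x s x-perm xs≡x
      xs-fresh g s≢g (inj₂ xs≡xg) = s≢g (·-cancelˡ x s g x-perm xs≡xg)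
      combine : InF t (x · s) ⊎ InF u x → InF u (x · s) ⊎ InF t x → ∃[ w ] IsPerm w × Corner k w
      combine (inj₁ xs-t) (inj₁ xs-u) = x · s , ·-perm x s x-perm , InF-· s x x-hit , xs-t , xs-u
      combine (inj₂ x-u)  (inj₂ x-t)  = x , x-perm , x-hit , x-t , x-u
      combine (inj₁ xs-t) (inj₂ x-t)  = ⊥-elim (xs-fresh t (sₖ≢tₖ k) (InF-unique t x (x · s) x-t xs-t))
      combine (inj₂ x-u)  (inj₁ xs-u) = ⊥-elim (xs-fresh u (λ ()) (InF-unique u x (x · s) x-u xs-u))

  -- Consecutive corners share the class ⟨1, k+3⟩, and ⟨1, k+2⟩ commutes with ⟨k+3, k+4⟩.
  module _ (k : Fin m) where
    private
      s t v : Gen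
      s = sₖ (inject₁ k)
      t = tₖ (inject₁ k)
      v = uₖ (suc k)

      d-fixed : τ s (hi v) ≡ hi v
      d-fixed = τ-fixes s (hi v) (λ ())
        (Finₚ.<⇒≢ (ℕₚ.<-trans (inject₁<suc (inject₁ k)) (s≤s (inject₁<suc k))) ∘ sym ∘ Finₚ.suc-injective)

    commute-square : ∀ y → y · v · s ≡ y · s · v
    commute-square = ·-square s v v
      (τ-fixes s (lo v) (λ ()) (Finₚ.<⇒≢ (inject₁<suc (inject₁ k)) ∘ sym ∘ Finₚ.suc-injective)) d-fixed

    ·s≢·t·v : ∀ {w} → IsPerm w → w · s ≢ w · t · v
    ·s≢·t·v {w} w-perm ws≡wtv = d≢0 (w-perm (hi v) zero (begin
      lookup w (hi v)             ≡⟨ cong (lookup w) d-fixed ⟨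
      lookup w (τ s (hi v))       ≡⟨ lookup-· w s (hi v) ⟨
      lookup (w · s) (hi v)       ≡⟨ cong (λ z → lookup z (hi v)) ws≡wtv ⟩
      lookup (w · t · v) (hi v)   ≡⟨ lookup-· (w · t) v (hi v) ⟩
      lookup (w · t) (τ v (hi v)) ≡⟨ cong (lookup (w · t)) (τ-hi v) ⟩
      lookup (w · t) (lo v)       ≡⟨ lookup-· w t (lo v) ⟩
      lookup w (τ t (lo v))       ≡⟨ cong (lookup w) (τ-hi t) ⟩
      lookup w zero               ∎))
      where
      open ≡-Reasoning
      d≢0 : hi v ≢ zero
      d≢0 ()

    ¬shifted-corner : ∀ {w} → IsPerm w → InF s w → ¬ InF v (w · t)
    ¬shifted-corner {w} w-perm w-s wt-v =
      via-switch-blocked (switch-blocked s v v w-perm (λ ()) (λ ()) commute-square w-s)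
      where
      via-switch-blocked : InF v (w · s) ⊎ InF v w → ⊥
      via-switch-blocked (inj₁ ws-v) = ws-fresh (InF-unique v (w · t) (w · s) wt-v ws-v)
        where
        ws-fresh : ¬ (w · s ≡ w · t ⊎ w · s ≡ w · t · v)
        ws-fresh (inj₁ ws≡wt)  = sₖ≢tₖ (inject₁ k) (·-cancelˡ w s t w-perm ws≡wt)
        ws-fresh (inj₂ ws≡wtv) = ·s≢·t·v {w} w-perm ws≡wtv
      via-switch-blocked (inj₂ w-v) = w-fresh (InF-unique v (w · t) w wt-v w-v)
        where
        w-fresh : ¬ (w ≡ w · t ⊎ w ≡ w · t · v)
        w-fresh (inj₁ w≡wt)  = ·-≢ w t w-perm (sym w≡wt)
        w-fresh (inj₂ w≡wtv) with () ← ·-cancelˡ w t v w-perm (·-transpose v (sym w≡wtv))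

    corner-chain : ∀ {w w′} → IsPerm w → Corner (inject₁ k) w → Corner (suc k) w′ → w′ ≡ w
    corner-chain {w} {w′} w-perm (w-s , w-t , _) (w′-s , _ , w′-v) = resolve (InF-unique t w w′ w-t w′-s)
      where
      resolve : w′ ≡ w ⊎ w′ ≡ w · t → w′ ≡ w
      resolve (inj₁ w′≡w)  = w′≡w
      resolve (inj₂ w′≡wt) = ⊥-elim (¬shifted-corner w-perm w-s (subst (InF v) w′≡wt w′-v))

  common-corner : ∃[ w ] IsPerm w × ∀ k → Corner k w
  common-corner = w , w-perm , <-weakInduction (λ k → Corner k w) (proj₂ (proj₂ (corner zero))) next
    where
    w = proj₁ (corner zero)
    w-perm = proj₁ (proj₂ (corner zero))
    next : ∀ k → Corner (inject₁ k) w → Corner (suc k) w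
    next k w-corner = subst (Corner (suc k)) (corner-chain k w-perm w-corner (proj₂ (proj₂ (corner (suc k)))))
                        (proj₂ (proj₂ (corner (suc k))))

  every-class-at-corner : ∀ {w} → (∀ k → Corner k w) → ∀ g → InF g w
  every-class-at-corner corners (inj₁ zero)    = proj₁ (corners zero)
  every-class-at-corner corners (inj₁ (suc i)) = proj₁ (proj₂ (corners i))
  every-class-at-corner corners (inj₂ k)       = proj₂ (proj₂ (corners k))

  trivial : IsTrivial F
  trivial = w , w-perm , All.tabulate incident
    where
    w = proj₁ common-corner
    w-perm = proj₁ (proj₂ common-corner)
    w-hit : ∀ g → InF g w
    w-hit = every-class-at-corner (proj₂ (proj₂ common-corner))
    incident-at : ∀ {u v} g → u ≡ v · g → InF g v → Incident w (u , v)
    incident-at {u} {v} g u≡vg v-hit = resolve (InF-unique g w v (w-hit g) v-hit)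
      where
      resolve : v ≡ w ⊎ v ≡ w · g → Incident w (u , v)
      resolve (inj₁ v≡w)  = inj₂ (sym v≡w)
      resolve (inj₂ v≡wg) = inj₁ (sym (trans u≡vg (sym (·-transpose g (sym v≡wg)))))
    incident : ∀ {e} → e ∈ F → Incident w e
    incident {u , v} e∈F = incident-at g u≡vg
      (Any.map (λ e≡ → subst (SameEdge (v , v · g)) e≡ (inj₂ (refl , sym u≡vg))) e∈F)
      where
      classified = adjacent⇒· {u} {v} (proj₂ (proj₂ (All.lookup F-edges e∈F)))
      g = proj₁ classified
      u≡vg = proj₂ classified

theorem3p6 : ∀ (n : ℕ) → 3 ≤ suc n → ∀ (F : List (Pair (suc n))) →
    IsOptimalMPS F → IsTrivial F
theorem3p6 zero          (s≤s ())
theorem3p6 (suc zero)    (s≤s (s≤s ()))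
theorem3p6 (suc (suc m)) _ F ((F-edgeSet , no-perfect , _) , optimal) =
  SmallPreclusionSet.trivial m F (proj₁ F-edgeSet) no-perfect
    (subst (length F ≤_) (length-star identity) (optimal (star identity) (star-isMPS identity-perm)))
  where open BubbleSortStar (suc m)
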